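{- Let $\mathcal{X}$ be an $n$-premaniplex with a vertex $x$, let $(\mathcal{Y},\eta)$ be an $(n,m)$-voltage operator with a vertex $y$, and let $\gamma\in\mathrm{Aut}(\mathcal{X})$. Then the automorphism $(x',y')\mapsto(x'\gamma,y')$ of $\mathcal{X}\rtimes_\eta\mathcal{Y}$ is an automorphism of the rooted premaniplex $(\mathcal{X}\rtimes_\eta\mathcal{Y},(x,y))$ (i.e. it maps the connected component of $(x,y)$ to itself) if and only if there exists a closed path $W$ in $\mathcal{Y}$ based at $y$ such that $x\gamma=\eta(W)x$.
   Context: Graphs may have semiedges and parallel edges. An $n$-premaniplex is a graph whose darts are colored by $\{0,\dots,n-1\}$ (a dart and its inverse have the same color) such that every vertex is the starting point of exactly one dart of each color, and for $|i-j|\ge 2$ every path of length 4 alternating colors $i,j$ is closed. For a vertex $x$, ${}^i x$ denotes the dart of color $i$ starting at $x$, and $x^i$ its endpoint. Automorphisms act on the right. The group $\mathrm{Mon}(\mathcal U^n)=\langle r_0,\dots,r_{n-1}\mid r_i^2=1,\ (r_ir_j)^2=1 \text{ for } |i-j|\ge2\rangle$ acts on the left on the vertex set of every $n$-premaniplex by $r_i x=x^i$. A voltage assignment $\eta$ with group $G$ assigns $\eta(d)\in G$ to each dart $d$ with $\eta(d^{ -1})=\eta(d)^{ -1}$; the voltage of a path $d_1\cdots d_k$ is $\eta(d_k)\cdots\eta(d_1)$. An $(n,m)$-voltage operator is a pair $(\mathcal Y,\eta)$ with $\mathcal Y$ an $m$-premaniplex and $\eta$ a voltage assignment with group $\mathrm{Mon}(\mathcal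 U^n)$ such that every length-4 path alternating between colors $i,j$ with $|i-j|\ge2$ has trivial voltage. For an $n$-premaniplex $\mathcal X$, $\mathcal X\rtimes_\eta\mathcal Y$ is the $m$-premaniplex on $V(\mathcal X)\times V(\mathcal Y)$ where for each color $i$ there is an edge of color $i$ joining $(x,y)$ and $(\eta({}^i y)x,\ y^i)$; for $\gamma\in\mathrm{Aut}(\mathcal X)$ the map $(x,y)\mapsto(x\gamma,y)$ is an automorphism of it. A rooted premaniplex $(\mathcal Z,z)$ is the connected component of $\mathcal Z$ containing $z$, with root $z$. -}

module Defs where

open import Data.Nat using (ℕ; _+_; _≤_)
open import Data.Fin using (Fin; toℕ)
open import Data.List using (List; []; _∷_; _++_; reverse; [_])
open import Data.List.Properties using (++-assoc; reverse-++; ++-identityʳ)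
open import Data.Product using (Σ; _×_; _,_; proj₁; proj₂)
open import Data.Sum using (_⊎_; inj₁; inj₂)
open import Relation.Binary.PropositionalEquality
  using (_≡_; refl; sym; trans; cong; cong₂; subst)

Far : ∀ {n} → Fin n → Fin n → Set
Far i j = (toℕ i + 2 ≤ toℕ j) ⊎ (toℕ j + 2 ≤ toℕ i)

-- Since every vertex is the start of exactly one dart
-- of each colour, a dart is determined by (start vertex, colour); the
-- dart  ⁱx  is represented by the pair (x , i), its endpoint is  step i x
-- (= xⁱ), and its inverse dart is (step i x , i).  Semiedges are the
-- darts with step i x ≡ x; parallel edges are allowed.

record Premaniplex (n : ℕ) : Set₁ where
  field
    V     : Set
    step  : Fin n → V → V
    invol : ∀ i x → step i (step i x) ≡ x
    comm  : ∀ i j → Far i j → ∀ x →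
            step j (step i (step j (step i x))) ≡ x
open Premaniplex public

walk : ∀ {n} (P : Premaniplex n) → List (Fin n) → V P → V P
walk P []       x = x
walk P (c ∷ cs) x = walk P cs (step P c x)

Connected : ∀ {n} (P : Premaniplex n) → V P → V P → Set
Connected {n} P a b = Σ (List (Fin n)) λ cs → walk P cs a ≡ b

-- Automorphisms (acting on the right: x ↦ x γ).
record Aut {n} (P : Premaniplex n) : Set where
  field
    fun      : V P → V P
    inv      : V P → V P
    inv-left : ∀ x → inv (fun x) ≡ x
    inv-right : ∀ x → fun (inv x) ≡ x
    preserve : ∀ i x → fun (step P i x) ≡ step P i (fun x)
open Aut public

-- Mon(𝒰ⁿ) = ⟨ r₀,…,r_{n-1} | rᵢ² , (rᵢ rⱼ)² for |i-j| ≥ 2 ⟩,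
-- presented as words in the generators modulo the congruence generated
-- by the relations.  The word  i₁ ∷ … ∷ i_k ∷ []  denotes r_{i₁}⋯r_{i_k};
-- product is _++_, identity is [], inverse is reverse (generators are
-- involutions).

Word : ℕ → Set
Word n = List (Fin n)

infix 4 _≈M_
data _≈M_ {n : ℕ} : Word n → Word n → Set where
  ≈refl  : ∀ {u} → u ≈M u
  ≈sym   : ∀ {u v} → u ≈M v → v ≈M u
  ≈trans : ∀ {u v w} → u ≈M v → v ≈M w → u ≈M w
  ≈cong  : ∀ {u u' v v'} → u ≈M u' → v ≈M v' → u ++ v ≈M u' ++ v'
  ≈invol : ∀ i → (i ∷ i ∷ []) ≈M []
  ≈comm  : ∀ i j → Far i j → (i ∷ j ∷ i ∷ j ∷ []) ≈M []

Mon-inv : ∀ {n} → Word n → Word n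
Mon-inv = reverse

act : ∀ {n} (P : Premaniplex n) → Word n → V P → V P
act P []       x = x
act P (i ∷ w) x = step P i (act P w x)

-- Voltages on an m-premaniplex Y with group Mon(𝒰ⁿ):  η y i  is the
-- voltage of the dart ⁱy.  Voltage of the path d₁⋯d_k (colours cs,
-- starting at y) is η(d_k)⋯η(d₁).

pathVoltage : ∀ {n m} (Y : Premaniplex m) → (V Y → Fin m → Word n) →
              List (Fin m) → V Y → Word n
pathVoltage Y η []       y = []
pathVoltage Y η (c ∷ cs) y = pathVoltage Y η cs (step Y c y) ++ η y c

record VoltageOperator (n m : ℕ) : Set₁ where
  field
    Y       : Premaniplex m
    η       : V Y → Fin m → Word n
    η-inv   : ∀ i y → η (step Y i y) i ≈M Mon-inv (η y i)
    η-comm  : ∀ i j → Far i j → ∀ y →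
              pathVoltage Y η (i ∷ j ∷ i ∷ j ∷ []) y ≈M []
open VoltageOperator public

Far-sym : ∀ {n} {i j : Fin n} → Far i j → Far j i
Far-sym (inj₁ a) = inj₂ a
Far-sym (inj₂ a) = inj₁ a

act-resp : ∀ {n} (P : Premaniplex n) {u v : Word n} → u ≈M v →
           ∀ x → act P u x ≡ act P v x
act-++ : ∀ {n} (P : Premaniplex n) (u v : Word n) x →
         act P (u ++ v) x ≡ act P u (act P v x)
act-++ P []      v x = refl
act-++ P (i ∷ u) v x = cong (step P i) (act-++ P u v x)

act-resp P ≈refl x = refl
act-resp P (≈sym p) x = sym (act-resp P p x)
act-resp P (≈trans p q) x = trans (act-resp P p x) (act-resp P q x)
act-resp P (≈cong {u} {u'} {v} {v'} p q) x =
  trans (act-++ P u v x)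
  (trans (cong (act P u) (act-resp P q x))
  (trans (act-resp P p (act P v' x)) (sym (act-++ P u' v' x))))
act-resp P (≈invol i) x = invol P i x
act-resp P (≈comm i j f) x = comm P j i (Far-sym f) x

act-reverse : ∀ {n} (P : Premaniplex n) (w : Word n) x →
              act P (reverse w) (act P w x) ≡ x
act-reverse P [] x = refl
act-reverse P (i ∷ w) x =
  trans (cong (λ u → act P u (step P i (act P w x))) (reverse-++ [ i ] w))
  (trans (act-++ P (reverse w) [ i ] (step P i (act P w x)))
  (trans (cong (act P (reverse w)) (invol P i (act P w x)))
         (act-reverse P w x)))

⋊step : ∀ {n m} (X : Premaniplex n) (O : VoltageOperator n m) →
        Fin m → V X × V (Y O) → V X × V (Y O)
⋊step X O i (x , y) = act X (η O y i) x , step (Y O) i y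

⋊walk : ∀ {n m} (X : Premaniplex n) (O : VoltageOperator n m) →
        List (Fin m) → V X × V (Y O) → V X × V (Y O)
⋊walk X O []       p = p
⋊walk X O (c ∷ cs) p = ⋊walk X O cs (⋊step X O c p)

⋊walk-act : ∀ {n m} (X : Premaniplex n) (O : VoltageOperator n m)
            (cs : List (Fin m)) x y →
            proj₁ (⋊walk X O cs (x , y)) ≡ act X (pathVoltage (Y O) (η O) cs y) x
⋊walk-act X O [] x y = refl
⋊walk-act X O (c ∷ cs) x y =
  trans (⋊walk-act X O cs (act X (η O y c) x) (step (Y O) c y))
        (sym (act-++ X (pathVoltage (Y O) (η O) cs (step (Y O) c y)) (η O y c) x))

infixl 5 _⋊_
_⋊_ : ∀ {n m} (X : Premaniplex n) (O : VoltageOperator n m) → Premaniplex m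
_⋊_ X O = record
  { V     = V X × V (Y O)
  ; step  = ⋊step X O
  ; invol = λ { i (x , y) → cong₂ _,_
      (trans (act-resp X (η-inv O i y) (act X (η O y i) x))
             (act-reverse X (η O y i) x))
      (invol (Y O) i y) }
  ; comm  = λ { i j f (x , y) → cong₂ _,_
      (trans (⋊walk-act X O (i ∷ j ∷ i ∷ j ∷ []) x y)
             (act-resp X (η-comm O i j f y) x))
      (comm (Y O) i j f y) }
  }

liftAut : ∀ {n m} {X : Premaniplex n} (O : VoltageOperator n m) →
          Aut X → V (X ⋊ O) → V (X ⋊ O)
liftAut O γ (x' , y') = fun γ x' , y'

{-# OPTIONS --safe #-}
module Submission where

-- An automorphism α of a premaniplex commutes with walks, so it maps the
-- component of r onto the component of α r; hence it fixes the component of r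
-- as soon as α r lies in it, and then α⁻¹ provides the preimages.  In X ⋊_η Y
-- the walk with colour sequence W from (x , y) ends at (η(W) x , yᵂ), so
-- (x γ , y) is in the component of (x , y) exactly when some closed walk W
-- at y has η(W) x = x γ.

open import Defs
open import Data.List using (List; []; _∷_; _++_; reverse; [_])
open import Data.List.Properties using (unfold-reverse)
open import Data.Fin using (Fin)
open import Data.Product using (Σ; _×_; _,_; proj₁; proj₂)
open import Function.Bundles using (_⇔_; mk⇔)
open import Function.Construct.Composition using (_⇔-∘_)
open import Relation.Binary.PropositionalEquality
  using (_≡_; refl; sym; trans; cong; cong₂; subst; module ≡-Reasoning)

module _ {n} (P : Premaniplex n) where

  walk-++ : ∀ as bs p → walk P (as ++ bs) p ≡ walk P bs (walk P as p)
  walk-++ []       bs p = refl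
  walk-++ (c ∷ as) bs p = walk-++ as bs (step P c p)

  walk-reverse : ∀ cs p → walk P (reverse cs) (walk P cs p) ≡ p
  walk-reverse []       p = refl
  walk-reverse (c ∷ cs) p = begin
    walk P (reverse (c ∷ cs)) q          ≡⟨ cong (λ l → walk P l q) (unfold-reverse c cs) ⟩
    walk P (reverse cs ++ [ c ]) q       ≡⟨ walk-++ (reverse cs) [ c ] q ⟩
    step P c (walk P (reverse cs) q)     ≡⟨ cong (step P c) (walk-reverse cs (step P c p)) ⟩
    step P c (step P c p)                ≡⟨ invol P c p ⟩
    p                                    ∎
    where
    open ≡-Reasoning
    q = walk P cs (step P c p)

  Connected-trans : ∀ {a b c} → Connected P a b → Connected P b c → Connected P a c
  Connected-trans (as , a→b) (bs , b→c) =
    as ++ bs , trans (walk-++ as bs _) (trans (cong (walk P bs) a→b) b→c)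

  Connected-sym : ∀ {a b} → Connected P a b → Connected P b a
  Connected-sym {a} (cs , a→b) =
    reverse cs , trans (cong (walk P (reverse cs)) (sym a→b)) (walk-reverse cs a)

  act-fun : (α : Aut P) → ∀ w p → fun α (act P w p) ≡ act P w (fun α p)
  act-fun α []      p = refl
  act-fun α (i ∷ w) p = trans (preserve α i (act P w p)) (cong (step P i) (act-fun α w p))

  walk-fun : (α : Aut P) → ∀ cs p → walk P cs (fun α p) ≡ fun α (walk P cs p)
  walk-fun α []       p = refl
  walk-fun α (c ∷ cs) p =
    trans (cong (walk P cs) (sym (preserve α c p))) (walk-fun α cs (step P c p))

  Connected-map : (α : Aut P) → ∀ {a b} → Connected P a b →
                  Connected P (fun α a) (fun α b)
  Connected-map α {a} (cs , a→b) = cs , trans (walk-fun α cs a) (cong (fun α) a→b)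

  Aut-inverse : Aut P → Aut P
  Aut-inverse α = record
    { fun       = inv α
    ; inv       = fun α
    ; inv-left  = inv-right α
    ; inv-right = inv-left α
    ; preserve  = inv-preserve
    }
    where
    open ≡-Reasoning
    inv-preserve : ∀ i p → inv α (step P i p) ≡ step P i (inv α p)
    inv-preserve i p = begin
      inv α (step P i p)                    ≡⟨ cong (λ q → inv α (step P i q)) (sym (inv-right α p)) ⟩
      inv α (step P i (fun α (inv α p)))    ≡⟨ cong (inv α) (sym (preserve α i (inv α p))) ⟩
      inv α (fun α (step P i (inv α p)))    ≡⟨ inv-left α _ ⟩
      step P i (inv α p)                    ∎

  MapsComponentOnto : V P → (V P → V P) → Set
  MapsComponentOnto r f =
    (∀ v → Connected P r v → Connected P r (f v)) ×
    (∀ w → Connected P r w → Σ (V P) λ v → Connected P r v × f v ≡ w)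

  mapsComponentOnto⇔connected : (α : Aut P) (r : V P) →
                                MapsComponentOnto r (fun α) ⇔ Connected P r (fun α r)
  mapsComponentOnto⇔connected α r = mk⇔ (λ (into , _) → into r ([] , refl)) onto
    where
    onto : Connected P r (fun α r) → MapsComponentOnto r (fun α)
    onto r→αr = (λ v r→v → Connected-trans r→αr (Connected-map α r→v))
              , (λ w r→w → inv α w
                         , Connected-trans r→α⁻¹r (Connected-map (Aut-inverse α) r→w)
                         , inv-right α w)
      where
      r→α⁻¹r : Connected P r (inv α r)
      r→α⁻¹r = Connected-sym (subst (Connected P (inv α r)) (inv-left α r)
                                    (Connected-map (Aut-inverse α) r→αr))

module _ {n m} (X : Premaniplex n) (O : VoltageOperator n m) where

  walk-⋊ : ∀ cs x y → walk (X ⋊ O) cs (x , y) ≡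
                      (act X (pathVoltage (Y O) (η O) cs y) x , walk (Y O) cs y)
  walk-⋊ []       x y = refl
  walk-⋊ (c ∷ cs) x y =
    trans (walk-⋊ cs (act X (η O y c) x) (step (Y O) c y))
          (cong (_, walk (Y O) cs (step (Y O) c y))
                (sym (act-++ X (pathVoltage (Y O) (η O) cs (step (Y O) c y)) (η O y c) x)))

  connected-⋊⇔ : ∀ {x y x′ y′} →
                 Connected (X ⋊ O) (x , y) (x′ , y′) ⇔
                 Σ (List (Fin m)) λ W →
                   walk (Y O) W y ≡ y′ × x′ ≡ act X (pathVoltage (Y O) (η O) W y) x
  connected-⋊⇔ {x} {y} = mk⇔
    (λ (W , ends) → let ends′ = trans (sym (walk-⋊ W x y)) ends
                    in W , cong proj₂ ends′ , sym (cong proj₁ ends′))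
    (λ (W , closes , voltage) → W , trans (walk-⋊ W x y) (cong₂ _,_ (sym voltage) closes))

  ⋊-lift : Aut X → Aut (X ⋊ O)
  ⋊-lift γ = record
    { fun       = liftAut O γ
    ; inv       = liftAut O (Aut-inverse X γ)
    ; inv-left  = λ (x , y) → cong (_, y) (inv-left γ x)
    ; inv-right = λ (x , y) → cong (_, y) (inv-right γ x)
    ; preserve  = λ i (x , y) → cong (_, step (Y O) i y) (act-fun X γ (η O y i) x)
    }

proposition5p2 : ∀ {n m} (X : Premaniplex n) (x : V X)
                 (O : VoltageOperator n m) (y : V (Y O)) (γ : Aut X) →
                 ( ( (∀ v → Connected (X ⋊ O) (x , y) v →
                            Connected (X ⋊ O) (x , y) (liftAut O γ v))
                   × (∀ w → Connected (X ⋊ O) (x , y) w →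
                            Σ (V (X ⋊ O)) λ v →
                              Connected (X ⋊ O) (x , y) v × liftAut O γ v ≡ w) )
                 ⇔ Σ (List (Fin m)) λ W →
                     walk (Y O) W y ≡ y
                     × fun γ x ≡ act X (pathVoltage (Y O) (η O) W y) x )
proposition5p2 X x O y γ =
  connected-⋊⇔ X O ⇔-∘ mapsComponentOnto⇔connected (X ⋊ O) (⋊-lift X O γ) (x , y)
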